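{- Let $k\ge1$ and $2\le r\le k+1$ be integers, $n=T_k+r$, and let $A$ be the augmented Heaviside sequence of mass $n$: $A_i=0$ for $i>T_k+1$, and for $1\le i\le T_k+1$, $A_i=2$ if $i=T_p+1$ for some $p\in\{k-r+2,\dots,k\}$ and $A_i=1$ otherwise. Then $\Phi^{T_k}(A)$ is an $(r-2)$-biaugmented marching group of order $k$, and the depth of $A$ is exactly $T_k+(r-2)(k+2)+2$.
   Context: $T_j=j(j+1)/2$. A mancala configuration is $\lambda:\mathbb N^*\to\mathbb N$ with support $\{1,\dots,\ell\}$ for some $\ell\ge0$. Move $\Phi$: $\mu=\Phi(\lambda)$, $\mu_i=\lambda_{i+1}+1$ for $1\le i\le\lambda_1$, $\mu_i=\lambda_{i+1}$ for $i>\lambda_1$; $\Phi^t$ its iterate. Componentwise order; $\lambda<\mu$ means $\lambda\le\mu$, $\lambda\ne\mu$. Marching group $M^j_i=j-i+1$ for $i\le j$, $0$ otherwise. Augmented marching group: mancala $\lambda$ with $M^j\le\lambda<M^{j+1}$ for some $j\ge0$. Depth of $\lambda$: least $t\ge0$ with $\Phi^t(\lambda)$ an augmented marching group. For $0\le q<k$, a $q$-biaugmented marching group of order $k$ is a configuration $M^k+\epsilon$ with $\epsilon_1=2$, $\epsilon_i=1$ for $2\le i\le q+1$, $\epsilon_{q+2}=0$, $\epsilon_i\in\{0,1\}$ for $q+3\le i\le k+1$, $\epsilon_i=0$ for $i>k+1$. -}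

module Defs where

open import Data.Nat using (ℕ; zero; suc; _+_; _*_; _∸_; _≤_; _<_; _≤ᵇ_; _≡ᵇ_)
open import Data.Bool using (Bool; true; false; if_then_else_; _∧_)
open import Data.List using (List; upTo)
open import Data.Bool.ListAction using (any)
open import Data.Sum using (_⊎_)
open import Data.Product using (Σ; ∃; ∃-syntax; _×_)
open import Relation.Binary.PropositionalEquality using (_≡_; _≢_)
open import Relation.Nullary using (¬_)

T : ℕ → ℕ
T zero    = 0
T (suc j) = T j + suc j

-- Configurations: functions ℕ → ℕ; only indices i ≥ 1 are meaningful
-- (the value at index 0 is ignored by every predicate below).
Config : Set
Config = ℕ → ℕ

IsMancala : Config → Set
IsMancala λc = ∃[ ℓ ] (∀ i → 1 ≤ i → (i ≤ ℓ → λc i ≢ 0) × (ℓ < i → λc i ≡ 0))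

Φ : Config → Config
Φ λc zero    = 0
Φ λc (suc i) = λc (suc (suc i)) + (if suc i ≤ᵇ λc 1 then 1 else 0)

Φ^ : ℕ → Config → Config
Φ^ zero    λc = λc
Φ^ (suc t) λc = Φ (Φ^ t λc)

_≤c_ : Config → Config → Set
λc ≤c μ = ∀ i → 1 ≤ i → λc i ≤ μ i

_≈c_ : Config → Config → Set
λc ≈c μ = ∀ i → 1 ≤ i → λc i ≡ μ i

_<c_ : Config → Config → Set
λc <c μ = (λc ≤c μ) × ¬ (λc ≈c μ)

M : ℕ → Config
M j zero    = 0
M j (suc i) = suc j ∸ suc i

IsAugMarching : Config → Set
IsAugMarching λc = IsMancala λc × (∃[ j ] ((M j ≤c λc) × (λc <c M (suc j))))

HasDepth : Config → ℕ → Set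
HasDepth λc d = IsAugMarching (Φ^ d λc) × (∀ t → t < d → ¬ IsAugMarching (Φ^ t λc))

IsBiaugMarching : ℕ → ℕ → Config → Set
IsBiaugMarching q k λc =
  (q < k) ×
  (Σ (ℕ → ℕ) λ ε → ( (ε 1 ≡ 2)
          × (∀ i → 2 ≤ i → i ≤ q + 1 → ε i ≡ 1)
          × (ε (q + 2) ≡ 0)
          × (∀ i → q + 3 ≤ i → i ≤ k + 1 → (ε i ≡ 0 ⊎ ε i ≡ 1))
          × (∀ i → k + 1 < i → ε i ≡ 0)
          × (∀ i → 1 ≤ i → λc i ≡ M k i + ε i)))

isSpecial : ℕ → ℕ → ℕ → Bool
isSpecial k r i = any (λ p → ((k + 2 ∸ r) ≤ᵇ p) ∧ (i ≡ᵇ suc (T p))) (upTo (suc k))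

A : ℕ → ℕ → Config
A k r zero    = 0
A k r (suc i) = if suc i ≤ᵇ suc (T k)
                then (if isSpecial k r (suc i) then 2 else 1)
                else 0

-- A configuration M^J + ε whose first entry ε₁ is at most 1 moves to M^J + ε′, where ε′ is ε
-- shifted one place to the left with ε₁ added J + 1 places further on: the marching group
-- absorbs the first pile. So 0/1 perturbations of a marching group just rotate, and the augmented
-- marching groups, which are exactly the M^J + ε with ε ∈ {0,1}^(J+1), are closed under Φ.
--
-- The augmented Heaviside sequence is a concatenation of blocks (1 + s_p, 1, …, 1) of length
-- p + 1, where s_p = 1 exactly when p ≥ k + 2 − r. After T_m moves the first m + 1 blocks have
-- been absorbed into M^(m+1) + (s_m, …, s_0), so after T_k moves one reaches
-- M^k + (2, 1^q, 0^(k−q)) with q = r − 2, a q-biaugmented marching group. From then on the leading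
-- 2 carries one 1 from the front to the back every k + 2 moves; after q such rounds and two more
-- moves the perturbation is a 0/1 word, while one move earlier a pebble lies at position f₁ + 2,
-- which no augmented marching group allows. By closure under Φ the depth is T_k + q(k + 2) + 2.

module Submission where

open import Defs
open import Data.Nat using (ℕ; zero; suc; _+_; _*_; _∸_; _≤_; _<_; _≤ᵇ_; _≟_; z≤n; s≤s; z<s)
open import Data.Nat.Properties
open import Data.Bool using (true; false; if_then_else_) renaming (T to IsTrue)
open import Data.Bool.Properties using (if-float; T-∧; T-≡; ⇔→≡)
open import Data.List
  using (List; []; _∷_; _++_; [_]; length; replicate; drop; applyUpTo; applyDownFrom; upTo)
open import Data.List.Properties
  using (++-assoc; ++-identityʳ; length-++; length-replicate; length-applyUpTo; length-applyDownFrom)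
open import Data.List.Relation.Unary.All using (All; []; _∷_; all?)
import Data.List.Relation.Unary.All.Properties as All
import Data.List.Relation.Unary.Any.Properties as Any
open import Data.Product using (_×_; _,_; ∃-syntax)
open import Data.Sum using (_⊎_; inj₁; inj₂; [_,_]′)
open import Function using (_∘_; id; mk⇔; Equivalence)
open import Relation.Nullary using (¬_; yes; no; contradiction)
open import Relation.Binary.PropositionalEquality
  using (_≡_; _≢_; refl; sym; trans; cong; cong₂; subst; _≗_; _→-setoid_; module ≡-Reasoning)
import Relation.Binary.Reasoning.Setoid as SetoidReasoning

module ≗-Reasoning = SetoidReasoning (ℕ →-setoid ℕ)

-- Lists as finitely supported sequences

⟦_⟧ : List ℕ → ℕ → ℕ
⟦ []     ⟧ i       = 0
⟦ x ∷ xs ⟧ zero    = x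
⟦ x ∷ xs ⟧ (suc i) = ⟦ xs ⟧ i

⟦⟧-beyond : ∀ xs {i} → length xs ≤ i → ⟦ xs ⟧ i ≡ 0
⟦⟧-beyond []                 _        = refl
⟦⟧-beyond (x ∷ xs) {suc i} (s≤s le) = ⟦⟧-beyond xs le

⟦++⟧ʳ : ∀ xs {ys} i → ⟦ xs ++ ys ⟧ (length xs + i) ≡ ⟦ ys ⟧ i
⟦++⟧ʳ []       i = refl
⟦++⟧ʳ (x ∷ xs) i = ⟦++⟧ʳ xs i

⟦replicate-++⟧ˡ : ∀ {n x ys i} → i < n → ⟦ replicate n x ++ ys ⟧ i ≡ x
⟦replicate-++⟧ˡ {suc n} {i = zero}  _        = refl
⟦replicate-++⟧ˡ {suc n} {i = suc i} (s≤s lt) = ⟦replicate-++⟧ˡ lt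

⟦replicate-++⟧-intro : ∀ n {x ys} {g : ℕ → ℕ} → (∀ i → i < n → g i ≡ x) →
                       (∀ i → g (n + i) ≡ ⟦ ys ⟧ i) → ∀ i → g i ≡ ⟦ replicate n x ++ ys ⟧ i
⟦replicate-++⟧-intro zero    prefix suffix i       = suffix i
⟦replicate-++⟧-intro (suc n) prefix suffix zero    = prefix 0 z<s
⟦replicate-++⟧-intro (suc n) prefix suffix (suc i) =
  ⟦replicate-++⟧-intro n (λ j j<n → prefix (suc j) (s≤s j<n)) suffix i

⟦applyUpTo⟧ : ∀ g {n i} → i < n → ⟦ applyUpTo g n ⟧ i ≡ g i
⟦applyUpTo⟧ g {suc n} {zero}  _        = refl
⟦applyUpTo⟧ g {suc n} {suc i} (s≤s lt) = ⟦applyUpTo⟧ (g ∘ suc) lt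

All⇒⟦⟧ : ∀ {P : ℕ → Set} {xs} → All P xs → P 0 → ∀ i → P (⟦ xs ⟧ i)
All⇒⟦⟧ []         P0 i       = P0
All⇒⟦⟧ (px ∷ pxs) P0 zero    = px
All⇒⟦⟧ (px ∷ pxs) P0 (suc i) = All⇒⟦⟧ pxs P0 i

⟦⟧⇒All : ∀ {P : ℕ → Set} xs → (∀ i → i < length xs → P (⟦ xs ⟧ i)) → All P xs
⟦⟧⇒All []       _ = []
⟦⟧⇒All (x ∷ xs) h = h 0 z<s ∷ ⟦⟧⇒All xs (λ i i<n → h (suc i) (s≤s i<n))

length-++-[] : ∀ xs {y : ℕ} → length (xs ++ [ y ]) ≡ suc (length xs)
length-++-[] xs = trans (length-++ xs) (+-comm _ 1)

-- Pointwise sum of zero-padded lists; recursing on the right argument lets V ⊕ (x ∷ P) compute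
-- for an unknown V.
infixl 6 _⊕_
_⊕_ : List ℕ → List ℕ → List ℕ
xs ⊕ []       = xs
xs ⊕ (y ∷ ys) = (⟦ xs ⟧ 0 + y) ∷ (drop 1 xs ⊕ ys)

⟦⊕⟧ : ∀ xs ys i → ⟦ xs ⊕ ys ⟧ i ≡ ⟦ xs ⟧ i + ⟦ ys ⟧ i
⟦⊕⟧ xs       []       i       = sym (+-identityʳ _)
⟦⊕⟧ xs       (y ∷ ys) zero    = refl
⟦⊕⟧ []       (y ∷ ys) (suc i) = ⟦⊕⟧ [] ys i
⟦⊕⟧ (x ∷ xs) (y ∷ ys) (suc i) = ⟦⊕⟧ xs ys i

⊕-identityˡ : ∀ xs → [] ⊕ xs ≡ xs
⊕-identityˡ []       = refl
⊕-identityˡ (x ∷ xs) = cong (x ∷_) (⊕-identityˡ xs)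

⊕-++ : ∀ xs ys zs → length ys ≤ length xs → (xs ++ zs) ⊕ ys ≡ (xs ⊕ ys) ++ zs
⊕-++ xs       []       zs _        = refl
⊕-++ (x ∷ xs) (y ∷ ys) zs (s≤s le) = cong (x + y ∷_) (⊕-++ xs ys zs le)

⟦replicate-1⟧ : ∀ x i → ⟦ replicate x 1 ⟧ i ≡ (if suc i ≤ᵇ x then 1 else 0)
⟦replicate-1⟧ zero    i       = refl
⟦replicate-1⟧ (suc x) zero    = refl
⟦replicate-1⟧ (suc x) (suc i) = ⟦replicate-1⟧ x i

⟦bit⟧ : ∀ {x} → x ≤ 1 → ⟦ [ x ] ⟧ ≗ ⟦ replicate x 1 ⟧
⟦bit⟧ z≤n       zero    = refl
⟦bit⟧ z≤n       (suc i) = refl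
⟦bit⟧ (s≤s z≤n) i       = refl

≤ᵇ-true : ∀ {m n} → m ≤ n → (m ≤ᵇ n) ≡ true
≤ᵇ-true m≤n = Equivalence.to T-≡ (≤⇒≤ᵇ m≤n)

≤ᵇ-false : ∀ {m n} → n < m → (m ≤ᵇ n) ≡ false
≤ᵇ-false {m} {n} n<m with m ≤ᵇ n in eq
... | false = refl
... | true  = contradiction (≤ᵇ⇒≤ m n (subst IsTrue (sym eq) _)) (<⇒≱ n<m)

T-mono-≤ : ∀ {m n} → m ≤ n → T m ≤ T n
T-mono-≤ {zero}          _         = z≤n
T-mono-≤ {suc m} {suc n} (s≤s m≤n) = +-mono-≤ (T-mono-≤ m≤n) (s≤s m≤n)

T-mono-< : ∀ {m n} → m < n → T m < T n
T-mono-< {m} m<n = <-≤-trans (m<m+n (T m) z<s) (T-mono-≤ m<n)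

T-cancel-< : ∀ {m n} → T m < T n → m < n
T-cancel-< lt = ≰⇒> (λ n≤m → <⇒≱ lt (T-mono-≤ n≤m))

T-injective : ∀ {m n} → T m ≡ T n → m ≡ n
T-injective e = ≤-antisym (cancel (≤-reflexive e)) (cancel (≤-reflexive (sym e)))
  where
  cancel : ∀ {m n} → T m ≤ T n → m ≤ n
  cancel le = ≮⇒≥ (λ n<m → <⇒≱ (T-mono-< n<m) le)

-- Perturbed marching groups

Φ-cong : ∀ {f g} → f ≈c g → Φ f ≗ Φ g
Φ-cong f≈g zero    = refl
Φ-cong f≈g (suc i) =
  cong₂ (λ a b → a + (if suc i ≤ᵇ b then 1 else 0))
        (f≈g (suc (suc i)) (s≤s z≤n)) (f≈g 1 (s≤s z≤n))

Φ^-cong : ∀ n {f g} → f ≗ g → Φ^ n f ≗ Φ^ n g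
Φ^-cong zero    f≗g = f≗g
Φ^-cong (suc n) f≗g = Φ-cong (λ i _ → Φ^-cong n f≗g i)

Φ∘Φ^ : ∀ n f → Φ (Φ^ n f) ≡ Φ^ n (Φ f)
Φ∘Φ^ zero    f = refl
Φ∘Φ^ (suc n) f = cong Φ (Φ∘Φ^ n f)

Φ^-+ : ∀ m n f → Φ^ (m + n) f ≡ Φ^ n (Φ^ m f)
Φ^-+ zero    n f = refl
Φ^-+ (suc m) n f = trans (cong Φ (Φ^-+ m n f)) (Φ∘Φ^ n (Φ^ m f))

M⁺ : ℕ → (ℕ → ℕ) → Config
M⁺ J δ zero    = 0
M⁺ J δ (suc i) = M J (suc i) + δ i

M⁺-≡ : ∀ {J l l′} → l ≡ l′ → M⁺ J ⟦ l ⟧ ≗ M⁺ J ⟦ l′ ⟧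
M⁺-≡ refl i = refl

-- The first pile of M^J + (x, L, R) holds J + x pebbles: J of them rebuild M^J one place to the
-- left, the other x land on the first x entries after L.
Φ-M⁺-∷ : ∀ {J x E} L R → length L ≡ J → ⟦ E ⟧ ≗ ⟦ replicate x 1 ⟧ →
         Φ (M⁺ J ⟦ x ∷ L ++ R ⟧) ≗ M⁺ J ⟦ L ++ R ⊕ E ⟧
Φ-M⁺-∷ L R refl E≗ zero = refl
Φ-M⁺-∷ {x = x} {E} [] R refl E≗ (suc i) = begin
    (0 + ⟦ R ⟧ i) + (if suc i ≤ᵇ x then 1 else 0)
  ≡⟨ cong (⟦ R ⟧ i +_) (sym (trans (E≗ i) (⟦replicate-1⟧ x i))) ⟩
    ⟦ R ⟧ i + ⟦ E ⟧ i
  ≡⟨ sym (⟦⊕⟧ R E i) ⟩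
    ⟦ R ⊕ E ⟧ i
  ≡⟨ cong (_+ ⟦ R ⊕ E ⟧ i) (sym (0∸n≡0 i)) ⟩
    (0 ∸ i) + ⟦ R ⊕ E ⟧ i
  ∎ where open ≡-Reasoning
Φ-M⁺-∷ (y ∷ L) R refl E≗ (suc zero) = +-comm _ 1
Φ-M⁺-∷ (y ∷ L) R refl E≗ (suc (suc i)) = Φ-M⁺-∷ L R refl E≗ (suc i)

Φ-M⁺-last : ∀ {J x E} L → length L ≡ J → ⟦ E ⟧ ≗ ⟦ replicate x 1 ⟧ →
            Φ (M⁺ J ⟦ x ∷ L ⟧) ≗ M⁺ J ⟦ L ++ E ⟧
Φ-M⁺-last {J} {x} {E} L len E≗ = begin
    Φ (M⁺ J ⟦ x ∷ L ⟧)
  ≈⟨ Φ-cong (λ i _ → M⁺-≡ (cong (x ∷_) (sym (++-identityʳ L))) i) ⟩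
    Φ (M⁺ J ⟦ x ∷ L ++ [] ⟧)
  ≈⟨ Φ-M⁺-∷ L [] len E≗ ⟩
    M⁺ J ⟦ L ++ [] ⊕ E ⟧
  ≈⟨ M⁺-≡ (cong (L ++_) (⊕-identityˡ E)) ⟩
    M⁺ J ⟦ L ++ E ⟧
  ∎
  where open ≗-Reasoning

-- Each leading entry (at most 1) is dropped J + 1 places later, just behind the current window.
rotate : ∀ {J} P Q V → All (_≤ 1) P → length (P ++ Q) ≡ suc J →
         Φ^ (length P) (M⁺ J ⟦ P ++ Q ++ V ⟧) ≗ M⁺ J ⟦ Q ++ V ⊕ P ⟧
rotate [] Q V [] _ = λ _ → refl
rotate {J} (x ∷ P) Q V (x≤1 ∷ P≤1) len = begin
    Φ^ (suc (length P)) (M⁺ J ⟦ x ∷ P ++ Q ++ V ⟧)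
  ≈⟨ Φ^-cong (suc (length P)) (M⁺-≡ (cong (x ∷_) (sym (++-assoc P Q V)))) ⟩
    Φ^ (suc (length P)) (M⁺ J ⟦ x ∷ (P ++ Q) ++ V ⟧)
  ≡⟨ Φ∘Φ^ (length P) _ ⟩
    Φ^ (length P) (Φ (M⁺ J ⟦ x ∷ (P ++ Q) ++ V ⟧))
  ≈⟨ Φ^-cong (length P) (Φ-M⁺-∷ (P ++ Q) V (suc-injective len) (⟦bit⟧ x≤1)) ⟩
    Φ^ (length P) (M⁺ J ⟦ (P ++ Q) ++ v ∷ drop 1 V ⟧)
  ≈⟨ Φ^-cong (length P) (M⁺-≡ (trans (++-assoc P Q _) (cong (P ++_) (sym (++-assoc Q [ v ] _))))) ⟩
    Φ^ (length P) (M⁺ J ⟦ P ++ (Q ++ [ v ]) ++ drop 1 V ⟧)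
  ≈⟨ rotate P (Q ++ [ v ]) (drop 1 V) P≤1 len′ ⟩
    M⁺ J ⟦ (Q ++ [ v ]) ++ drop 1 V ⊕ P ⟧
  ≈⟨ M⁺-≡ (++-assoc Q [ v ] _) ⟩
    M⁺ J ⟦ Q ++ V ⊕ (x ∷ P) ⟧
  ∎
  where
  open ≗-Reasoning
  v = ⟦ V ⟧ 0 + x
  len′ : length (P ++ Q ++ [ v ]) ≡ suc J
  len′ = trans (cong length (sym (++-assoc P Q [ v ]))) (trans (length-++-[] (P ++ Q)) len)

M⁺-rebase : ∀ {J} L H → length L ≡ suc J →
            M⁺ J ⟦ (replicate (suc J) 1 ⊕ L) ++ H ⟧ ≗ M⁺ (suc J) ⟦ L ++ H ⟧
M⁺-rebase     (y ∷ L)  H len zero          = refl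
M⁺-rebase {J} (y ∷ L)  H len (suc zero)    = +-suc J y
M⁺-rebase {zero}  (y ∷ []) H len (suc (suc i)) = cong (_+ ⟦ H ⟧ i) (sym (0∸n≡0 i))
M⁺-rebase {suc J} (y ∷ L)  H len (suc (suc i)) = M⁺-rebase L H (suc-injective len) (suc i)

-- The 2 spills (1, 1) past the window of length k + 1; the next k + 1 moves rotate the window,
-- its leading 1 landing on the second spilled 1 to form the new leading 2.
round : ∀ {k} L → All (_≤ 1) L → length (1 ∷ L) ≡ k →
        Φ^ (k + 2) (M⁺ k ⟦ 2 ∷ 1 ∷ L ⟧) ≗ M⁺ k ⟦ 2 ∷ L ++ [ 1 ] ⟧
round {k} L L≤1 len = begin
    Φ^ (k + 2) (M⁺ k ⟦ 2 ∷ 1 ∷ L ⟧)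
  ≡⟨ trans (cong (λ t → Φ^ t (M⁺ k ⟦ 2 ∷ 1 ∷ L ⟧)) (+-comm k 2)) (Φ^-+ 1 (suc k) _) ⟩
    Φ^ (suc k) (Φ (M⁺ k ⟦ 2 ∷ 1 ∷ L ⟧))
  ≈⟨ Φ^-cong (suc k) (Φ-M⁺-last (1 ∷ L) len (λ _ → refl)) ⟩
    Φ^ (suc k) (M⁺ k ⟦ (1 ∷ L) ++ 1 ∷ 1 ∷ [] ⟧)
  ≈⟨ Φ^-cong (suc k) (M⁺-≡ (sym (++-assoc (1 ∷ L) [ 1 ] [ 1 ]))) ⟩
    Φ^ (suc k) (M⁺ k ⟦ P ++ [] ++ [ 1 ] ⟧)
  ≡⟨ cong (λ t → Φ^ t (M⁺ k ⟦ P ++ [ 1 ] ⟧)) (sym |P|) ⟩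
    Φ^ (length P) (M⁺ k ⟦ P ++ [] ++ [ 1 ] ⟧)
  ≈⟨ rotate P [] [ 1 ] (≤-refl ∷ All.++⁺ L≤1 (≤-refl ∷ []))
              (trans (cong length (++-identityʳ P)) |P|) ⟩
    M⁺ k ⟦ 2 ∷ [] ⊕ (L ++ [ 1 ]) ⟧
  ≈⟨ M⁺-≡ (cong (2 ∷_) (⊕-identityˡ (L ++ [ 1 ]))) ⟩
    M⁺ k ⟦ 2 ∷ L ++ [ 1 ] ⟧
  ∎
  where
  open ≗-Reasoning
  P = (1 ∷ L) ++ [ 1 ]
  |P| : length P ≡ suc k
  |P| = trans (length-++-[] (1 ∷ L)) (cong suc len)

rounds : ∀ {k} b L → All (_≤ 1) L → length (replicate b 1 ++ L) ≡ k →
         Φ^ (b * (k + 2)) (M⁺ k ⟦ 2 ∷ replicate b 1 ++ L ⟧) ≗ M⁺ k ⟦ 2 ∷ L ++ replicate b 1 ⟧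
rounds zero L L≤1 len = M⁺-≡ (cong (2 ∷_) (sym (++-identityʳ L)))
rounds {k} (suc b) L L≤1 len = begin
    Φ^ ((k + 2) + b * (k + 2)) (M⁺ k ⟦ 2 ∷ 1 ∷ replicate b 1 ++ L ⟧)
  ≡⟨ Φ^-+ (k + 2) (b * (k + 2)) _ ⟩
    Φ^ (b * (k + 2)) (Φ^ (k + 2) (M⁺ k ⟦ 2 ∷ 1 ∷ replicate b 1 ++ L ⟧))
  ≈⟨ Φ^-cong (b * (k + 2))
             (round (replicate b 1 ++ L) (All.++⁺ (All.replicate⁺ b ≤-refl) L≤1) len) ⟩
    Φ^ (b * (k + 2)) (M⁺ k ⟦ 2 ∷ (replicate b 1 ++ L) ++ [ 1 ] ⟧)
  ≈⟨ Φ^-cong (b * (k + 2)) (M⁺-≡ (cong (2 ∷_) (++-assoc (replicate b 1) L [ 1 ]))) ⟩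
    Φ^ (b * (k + 2)) (M⁺ k ⟦ 2 ∷ replicate b 1 ++ L ++ [ 1 ] ⟧)
  ≈⟨ rounds b (L ++ [ 1 ]) (All.++⁺ L≤1 (≤-refl ∷ [])) len′ ⟩
    M⁺ k ⟦ 2 ∷ (L ++ [ 1 ]) ++ replicate b 1 ⟧
  ≈⟨ M⁺-≡ (cong (2 ∷_) (++-assoc L [ 1 ] (replicate b 1))) ⟩
    M⁺ k ⟦ 2 ∷ L ++ replicate (suc b) 1 ⟧
  ∎
  where
  open ≗-Reasoning
  len′ : length (replicate b 1 ++ L ++ [ 1 ]) ≡ k
  len′ = trans (cong length (sym (++-assoc (replicate b 1) L [ 1 ])))
               (trans (length-++-[] (replicate b 1 ++ L)) len)

-- Augmented marching groups

sandwich⇒isMancala : ∀ {j f} → M j ≤c f → f ≤c M (suc j) → IsMancala f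
sandwich⇒isMancala {j} {f} lo hi = byLastSlot (f (suc j)) refl (hi (suc j) (s≤s z≤n))
  where
  positive : ∀ i → 1 ≤ i → i ≤ j → f i ≢ 0
  positive (suc i) _ i<j = >⇒≢ (<-≤-trans (m<n⇒0<n∸m i<j) (lo (suc i) (s≤s z≤n)))
  vanishing : ∀ i → suc j < i → f i ≡ 0
  vanishing (suc i) (s≤s sj≤i) =
    n≤0⇒n≡0 (≤-trans (hi (suc i) (s≤s z≤n)) (≤-reflexive (m≤n⇒m∸n≡0 sj≤i)))
  byLastSlot : ∀ b → f (suc j) ≡ b → b ≤ suc j ∸ j → IsMancala f
  byLastSlot zero fj≡0 _ = j , λ i 1≤i →
    positive i 1≤i ,
    λ j<i → [ vanishing i , (λ sj≡i → subst (λ x → f x ≡ 0) sj≡i fj≡0) ]′ (m≤n⇒m<n∨m≡n j<i)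
  byLastSlot (suc zero) fj≡1 _ = suc j , λ i 1≤i →
    (λ i≤sj → [ positive i 1≤i ∘ ≤-pred
              , (λ i≡sj → subst (λ x → f x ≢ 0) (sym i≡sj) (1+n≢0 ∘ trans (sym fj≡1)))
              ]′ (m≤n⇒m<n∨m≡n i≤sj)) ,
    vanishing i
  byLastSlot (suc (suc b)) _ 2≤1 =
    contradiction (≤-trans 2≤1 (≤-reflexive (m+n∸n≡m 1 j))) λ { (s≤s ()) }

IsBitMarching : Config → Set
IsBitMarching f = ∃[ J ] ∃[ l ] length l ≡ suc J × All (_≤ 1) l × f ≈c M⁺ J ⟦ l ⟧

M⁺-≤-M : ∀ {J l} → All (_≤ 1) l → length l ≤ suc J → M⁺ J ⟦ l ⟧ ≤c M (suc J)
M⁺-≤-M {J} {l} l≤1 len (suc i) _ with i ≤? J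
... | yes i≤J = begin
    (J ∸ i) + ⟦ l ⟧ i ≤⟨ +-monoʳ-≤ (J ∸ i) (All⇒⟦⟧ l≤1 z≤n i) ⟩
    (J ∸ i) + 1       ≡⟨ +-comm (J ∸ i) 1 ⟩
    suc (J ∸ i)       ≡⟨ sym (+-∸-assoc 1 i≤J) ⟩
    suc J ∸ i         ∎
  where open ≤-Reasoning
... | no  i≰J rewrite ⟦⟧-beyond l (≤-trans len (≰⇒> i≰J)) | +-identityʳ (J ∸ i) =
  ∸-monoˡ-≤ i (n≤1+n J)

notAllOnes⇒isAug : ∀ {J l f} → length l ≤ suc J → All (_≤ 1) l → ¬ All (_≡ 1) l →
                  f ≈c M⁺ J ⟦ l ⟧ → IsAugMarching f
notAllOnes⇒isAug {J} {l} {f} len l≤1 not-ones f≈ = sandwich⇒isMancala lo hi , J , lo , hi , not-M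
  where
  lo : M J ≤c f
  lo (suc i) _ = ≤-trans (m≤m+n _ _) (≤-reflexive (sym (f≈ (suc i) (s≤s z≤n))))
  hi : f ≤c M (suc J)
  hi i 1≤i = ≤-trans (≤-reflexive (f≈ i 1≤i)) (M⁺-≤-M l≤1 len i 1≤i)
  not-M : ¬ f ≈c M (suc J)
  not-M f≈M = not-ones (⟦⟧⇒All l (λ i i<|l| → one (≤-pred (≤-trans i<|l| len))))
    where
    one : ∀ {i} → i ≤ J → ⟦ l ⟧ i ≡ 1
    one {i} i≤J = +-cancelˡ-≡ (J ∸ i) _ _ (begin
      (J ∸ i) + ⟦ l ⟧ i ≡⟨ sym (f≈ (suc i) (s≤s z≤n)) ⟩
      f (suc i)         ≡⟨ f≈M (suc i) (s≤s z≤n) ⟩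
      suc J ∸ i         ≡⟨ +-∸-assoc 1 i≤J ⟩
      suc (J ∸ i)       ≡⟨ +-comm 1 (J ∸ i) ⟩
      (J ∸ i) + 1       ∎)
      where open ≡-Reasoning

M⁺-allOnes : ∀ {J l} → All (_≡ 1) l → length l ≡ suc J →
             ∀ i → M J (suc i) + ⟦ l ⟧ i ≡ M (suc J) (suc i)
M⁺-allOnes {J}     (refl ∷ _)  _   zero    = +-comm J 1
M⁺-allOnes {zero}  (refl ∷ []) _   (suc i) = sym (0∸n≡0 i)
M⁺-allOnes {suc J} (refl ∷ l≡1) len (suc i) = M⁺-allOnes l≡1 (suc-injective len) i

bits⇒isAug : ∀ {f} → IsBitMarching f → IsAugMarching f
bits⇒isAug {f} (J , l , len , l≤1 , f≈) with all? (_≟ 1) l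
... | no  not-ones = notAllOnes⇒isAug (≤-reflexive len) l≤1 not-ones f≈
... | yes ones     = notAllOnes⇒isAug (s≤s z≤n) (z≤n ∷ []) (λ { (() ∷ _) }) f≈M
  where
  -- An all-ones word gives M^J + (1, …, 1) = M^(J+1) = M^(J+1) + (0).
  f≈M : f ≈c M⁺ (suc J) ⟦ [ 0 ] ⟧
  f≈M (suc i) _ = begin
    f (suc i)                               ≡⟨ f≈ (suc i) (s≤s z≤n) ⟩
    M J (suc i) + ⟦ l ⟧ i                   ≡⟨ M⁺-allOnes ones len i ⟩
    M (suc J) (suc i)                       ≡⟨ sym (+-identityʳ _) ⟩
    M (suc J) (suc i) + 0                   ≡⟨ cong (M (suc J) (suc i) +_) (sym zero-at-i) ⟩
    M (suc J) (suc i) + ⟦ [ 0 ] ⟧ i         ∎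
    where
    open ≡-Reasoning
    zero-at-i : ⟦ [ 0 ] ⟧ i ≡ 0
    zero-at-i = All⇒⟦⟧ {P = _≡ 0} (refl ∷ []) refl i

isAug⇒bits : ∀ {f} → IsAugMarching f → IsBitMarching f
isAug⇒bits {f} (_ , j , lo , hi , _) =
  j , applyUpTo g (suc j) , length-applyUpTo g (suc j) , All.applyUpTo⁺₁ g (suc j) bit , f≈
  where
  g : ℕ → ℕ
  g i = f (suc i) ∸ M j (suc i)
  bit : ∀ {i} → i < suc j → g i ≤ 1
  bit {i} (s≤s i≤j) = begin
    f (suc i) ∸ (j ∸ i)       ≤⟨ ∸-monoˡ-≤ (j ∸ i) (hi (suc i) (s≤s z≤n)) ⟩
    suc j ∸ i ∸ (j ∸ i)       ≡⟨ cong (_∸ (j ∸ i)) (+-∸-assoc 1 i≤j) ⟩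
    suc (j ∸ i) ∸ (j ∸ i)     ≡⟨ m+n∸n≡m 1 (j ∸ i) ⟩
    1                         ∎
    where open ≤-Reasoning
  f≈ : f ≈c M⁺ j ⟦ applyUpTo g (suc j) ⟧
  f≈ (suc i) _ with i ≤? j
  ... | yes i≤j =
    sym (trans (cong (M j (suc i) +_) (⟦applyUpTo⟧ g (s≤s i≤j))) (m+[n∸m]≡n (lo (suc i) (s≤s z≤n))))
  ... | no  i≰j = trans f0 (sym (cong₂ _+_ (m≤n⇒m∸n≡0 (<⇒≤ j<i)) l0))
    where
    j<i = ≰⇒> i≰j
    l0 : ⟦ applyUpTo g (suc j) ⟧ i ≡ 0
    l0 = ⟦⟧-beyond (applyUpTo g (suc j)) (≤-trans (≤-reflexive (length-applyUpTo g (suc j))) j<i)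
    f0 : f (suc i) ≡ 0
    f0 = n≤0⇒n≡0 (≤-trans (hi (suc i) (s≤s z≤n)) (≤-reflexive (m≤n⇒m∸n≡0 j<i)))

isAug-resp-≈c : ∀ {f g} → f ≈c g → IsAugMarching f → IsAugMarching g
isAug-resp-≈c f≈g aug with J , l , len , l≤1 , f≈ ← isAug⇒bits aug =
  bits⇒isAug (J , l , len , l≤1 , λ i 1≤i → trans (sym (f≈g i 1≤i)) (f≈ i 1≤i))

isAug-Φ : ∀ {f} → IsAugMarching f → IsAugMarching (Φ f)
isAug-Φ aug with J , x ∷ L , len , x≤1 ∷ L≤1 , f≈ ← isAug⇒bits aug =
  bits⇒isAug (J , L ++ [ x ] , trans (length-++-[] L) len , All.++⁺ L≤1 (x≤1 ∷ []) ,
              λ i _ → trans (Φ-cong f≈ i) (Φ-M⁺-last L (suc-injective len) (⟦bit⟧ x≤1) i))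

isAug-Φ^-mono : ∀ {f m n} → m ≤ n → IsAugMarching (Φ^ m f) → IsAugMarching (Φ^ n f)
isAug-Φ^-mono {f} {m} {n} m≤n aug = subst (λ t → IsAugMarching (Φ^ t f)) (m+[n∸m]≡n m≤n)
  (subst IsAugMarching (sym (Φ^-+ m (n ∸ m) f)) (iterate (n ∸ m) aug))
  where
  iterate : ∀ t {g} → IsAugMarching g → IsAugMarching (Φ^ t g)
  iterate zero    aug = aug
  iterate (suc t) aug = isAug-Φ (iterate t aug)

isAug-gap : ∀ {f} → IsAugMarching f → f (suc (suc (f 1))) ≡ 0
isAug-gap {f} (_ , j , lo , hi , _) =
  n≤0⇒n≡0 (≤-trans (hi (suc (suc (f 1))) (s≤s z≤n)) (≤-reflexive (m≤n⇒m∸n≡0 (lo 1 (s≤s z≤n)))))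

isBiaug-intro : ∀ {q w B f} → All (_≤ 1) B → length B ≡ w →
                f ≈c M⁺ (q + suc w) ⟦ 2 ∷ replicate q 1 ++ 0 ∷ B ⟧ → IsBiaugMarching q (q + suc w) f
isBiaug-intro {q} {w} {B} {f} B≤1 |B| f≈ =
  m<m+n q z<s , ⟦ 0 ∷ 2 ∷ L ⟧ , refl , ones , gap , bits , beyond ,
  λ { (suc i) _ → f≈ (suc i) (s≤s z≤n) }
  where
  L = replicate q 1 ++ 0 ∷ B
  |L| : length L ≡ q + suc w
  |L| = trans (length-++ (replicate q 1)) (cong₂ _+_ (length-replicate q) (cong suc |B|))
  ones : ∀ i → 2 ≤ i → i ≤ q + 1 → ⟦ 0 ∷ 2 ∷ L ⟧ i ≡ 1
  ones (suc zero)    (s≤s ()) _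
  ones (suc (suc i)) _ i≤q+1 = ⟦replicate-++⟧ˡ (≤-pred (≤-trans i≤q+1 (≤-reflexive (+-comm q 1))))
  gap : ⟦ 0 ∷ 2 ∷ L ⟧ (q + 2) ≡ 0
  gap = trans (cong ⟦ 0 ∷ 2 ∷ L ⟧ (trans (+-comm q 2) (cong (2 +_) q≡))) (⟦++⟧ʳ (replicate q 1) 0)
    where
    q≡ : q ≡ length (replicate q 1) + 0
    q≡ = sym (trans (+-identityʳ _) (length-replicate q))
  bits : ∀ i → q + 3 ≤ i → i ≤ q + suc w + 1 → ⟦ 0 ∷ 2 ∷ L ⟧ i ≡ 0 ⊎ ⟦ 0 ∷ 2 ∷ L ⟧ i ≡ 1
  bits zero          _      _ = inj₁ refl
  bits (suc zero)    q+3≤1  _ = contradiction (≤-trans (m≤n+m 3 q) q+3≤1) λ { (s≤s ()) }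
  bits (suc (suc i)) _      _ = bit-cases (All⇒⟦⟧ (All.++⁺ (All.replicate⁺ q ≤-refl) (z≤n ∷ B≤1)) z≤n i)
    where
    bit-cases : ∀ {x} → x ≤ 1 → x ≡ 0 ⊎ x ≡ 1
    bit-cases z≤n       = inj₁ refl
    bit-cases (s≤s z≤n) = inj₂ refl
  beyond : ∀ i → q + suc w + 1 < i → ⟦ 0 ∷ 2 ∷ L ⟧ i ≡ 0
  beyond i k+1<i = ⟦⟧-beyond (0 ∷ 2 ∷ L)
    (≤-trans (≤-reflexive (cong suc (trans (cong suc |L|) (+-comm 1 (q + suc w))))) k+1<i)

-- The augmented Heaviside sequence

-- Blocks m, …, m + n of the augmented Heaviside sequence with bits s: block p is 1 + s p followed
-- by p ones and occupies positions T p + 1, …, T (p + 1); the last block is cut after its first entry.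
heaviside : (ℕ → ℕ) → ℕ → ℕ → List ℕ
heaviside s m zero    = [ suc (s m) ]
heaviside s m (suc n) = suc (s m) ∷ replicate m 1 ++ heaviside s (suc m) n

module _ {s : ℕ → ℕ} (s≤1 : ∀ p → s p ≤ 1) where

  open ≗-Reasoning

  heaviside-block : ∀ m n →
    Φ^ m (M⁺ m ⟦ applyDownFrom s m ++ heaviside s m (suc n) ⟧) ≗
    M⁺ (suc m) ⟦ applyDownFrom s (suc m) ++ heaviside s (suc m) n ⟧
  heaviside-block m n = begin
      Φ^ m (M⁺ m ⟦ P ++ suc (s m) ∷ replicate m 1 ++ H ⟧)
    ≡⟨ cong (λ t → Φ^ t (M⁺ m ⟦ P ++ suc (s m) ∷ replicate m 1 ++ H ⟧)) (sym |P|≡m) ⟩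
      Φ^ (length P) (M⁺ m ⟦ P ++ suc (s m) ∷ replicate m 1 ++ H ⟧)
    ≈⟨ rotate P [ suc (s m) ] (replicate m 1 ++ H) (All.applyDownFrom⁺₂ s m s≤1)
              (trans (length-++-[] P) (cong suc |P|≡m)) ⟩
      M⁺ m ⟦ suc (s m) ∷ (replicate m 1 ++ H) ⊕ P ⟧
    ≈⟨ M⁺-≡ (cong (suc (s m) ∷_) (⊕-++ (replicate m 1) P H
                                     (≤-reflexive (trans |P|≡m (sym (length-replicate m)))))) ⟩
      M⁺ m ⟦ (replicate (suc m) 1 ⊕ (s m ∷ P)) ++ H ⟧
    ≈⟨ M⁺-rebase (s m ∷ P) H (cong suc |P|≡m) ⟩
      M⁺ (suc m) ⟦ (s m ∷ P) ++ H ⟧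
    ∎
    where
    P = applyDownFrom s m
    H = heaviside s (suc m) n
    |P|≡m : length P ≡ m
    |P|≡m = length-applyDownFrom s m

  heaviside-march : ∀ m n →
    Φ^ (T m) (M⁺ 0 ⟦ heaviside s 0 (m + n) ⟧) ≗
    Φ^ m (M⁺ m ⟦ applyDownFrom s m ++ heaviside s m n ⟧)
  heaviside-march zero    n = λ _ → refl
  heaviside-march (suc m) n = begin
      Φ^ (T m + suc m) (M⁺ 0 ⟦ heaviside s 0 (suc m + n) ⟧)
    ≡⟨ Φ^-+ (T m) (suc m) _ ⟩
      Φ^ (suc m) (Φ^ (T m) (M⁺ 0 ⟦ heaviside s 0 (suc m + n) ⟧))
    ≡⟨ cong (λ t → Φ^ (suc m) (Φ^ (T m) (M⁺ 0 ⟦ heaviside s 0 t ⟧))) (sym (+-suc m n)) ⟩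
      Φ^ (suc m) (Φ^ (T m) (M⁺ 0 ⟦ heaviside s 0 (m + suc n) ⟧))
    ≈⟨ Φ^-cong (suc m) (heaviside-march m (suc n)) ⟩
      Φ^ (suc m) (Φ^ m (M⁺ m ⟦ applyDownFrom s m ++ heaviside s m (suc n) ⟧))
    ≈⟨ Φ^-cong (suc m) (heaviside-block m n) ⟩
      Φ^ (suc m) (M⁺ (suc m) ⟦ applyDownFrom s (suc m) ++ heaviside s (suc m) n ⟧)
    ∎

  heaviside-T : ∀ k →
    Φ^ (T k) (M⁺ 0 ⟦ heaviside s 0 k ⟧) ≗ M⁺ k ⟦ suc (s k) ∷ applyDownFrom s k ⟧
  heaviside-T k = begin
      Φ^ (T k) (M⁺ 0 ⟦ heaviside s 0 k ⟧)
    ≡⟨ cong (λ t → Φ^ (T k) (M⁺ 0 ⟦ heaviside s 0 t ⟧)) (sym (+-identityʳ k)) ⟩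
      Φ^ (T k) (M⁺ 0 ⟦ heaviside s 0 (k + 0) ⟧)
    ≈⟨ heaviside-march k 0 ⟩
      Φ^ k (M⁺ k ⟦ P ++ [ suc (s k) ] ⟧)
    ≡⟨ cong (λ t → Φ^ t (M⁺ k ⟦ P ++ [ suc (s k) ] ⟧)) (sym |P|≡k) ⟩
      Φ^ (length P) (M⁺ k ⟦ P ++ [ suc (s k) ] ++ [] ⟧)
    ≈⟨ rotate P [ suc (s k) ] [] (All.applyDownFrom⁺₂ s k s≤1)
              (trans (length-++-[] P) (cong suc |P|≡k)) ⟩
      M⁺ k ⟦ suc (s k) ∷ [] ⊕ P ⟧
    ≈⟨ M⁺-≡ (cong (suc (s k) ∷_) (⊕-identityˡ P)) ⟩
      M⁺ k ⟦ suc (s k) ∷ P ⟧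
    ∎
    where
    P = applyDownFrom s k
    |P|≡k : length P ≡ k
    |P|≡k = length-applyDownFrom s k

atLeast : ℕ → ℕ → ℕ
atLeast t p = if t ≤ᵇ p then 1 else 0

atLeast-≤1 : ∀ t p → atLeast t p ≤ 1
atLeast-≤1 t p with t ≤ᵇ p
... | true  = ≤-refl
... | false = z≤n

applyDownFrom-atLeast : ∀ q w → applyDownFrom (atLeast w) (q + w) ≡ replicate q 1 ++ replicate w 0
applyDownFrom-atLeast zero    w = allZero w ≤-refl
  where
  allZero : ∀ n → n ≤ w → applyDownFrom (atLeast w) n ≡ replicate n 0
  allZero zero    _   = refl
  allZero (suc n) n<w = cong₂ _∷_ (cong (λ b → if b then 1 else 0) (≤ᵇ-false n<w)) (allZero n (<⇒≤ n<w))
applyDownFrom-atLeast (suc q) w =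
  cong₂ _∷_ (cong (λ b → if b then 1 else 0) (≤ᵇ-true (m≤n+m w q))) (applyDownFrom-atLeast q w)

module _ {k r : ℕ} where

  isSpecial-sound : ∀ {j} → IsTrue (isSpecial k r (suc j)) →
                    ∃[ p ] IsTrue (k + 2 ∸ r ≤ᵇ p) × j ≡ T p
  isSpecial-sound {j} special
    with p , _ , hit ← Any.applyUpTo⁻ id (Any.any⁻ _ (upTo (suc k)) special)
    with t≤p , same ← Equivalence.to T-∧ hit
    = p , t≤p , ≡ᵇ⇒≡ j (T p) same

  isSpecial-complete : ∀ {p} → p ≤ k → IsTrue (k + 2 ∸ r ≤ᵇ p) →
                       IsTrue (isSpecial k r (suc (T p)))
  isSpecial-complete {p} p≤k t≤p =
    Any.any⁺ _ (Any.applyUpTo⁺ id (Equivalence.from T-∧ (t≤p , ≡⇒≡ᵇ (T p) (T p) refl)) (s≤s p≤k))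

  isSpecial-T : ∀ {p} → p ≤ k → isSpecial k r (suc (T p)) ≡ (k + 2 ∸ r ≤ᵇ p)
  isSpecial-T {p} p≤k = ⇔→≡ (mk⇔
    (Equivalence.to T-≡ ∘ sound ∘ Equivalence.from T-≡)
    (Equivalence.to T-≡ ∘ isSpecial-complete p≤k ∘ Equivalence.from T-≡))
    where
    sound : IsTrue (isSpecial k r (suc (T p))) → IsTrue (k + 2 ∸ r ≤ᵇ p)
    sound special with p′ , t≤p′ , Tp≡Tp′ ← isSpecial-sound {T p} special =
      subst (λ x → IsTrue (k + 2 ∸ r ≤ᵇ x)) (sym (T-injective Tp≡Tp′)) t≤p′

  isSpecial-inside : ∀ {p m} → 0 < m → m ≤ p → ¬ IsTrue (isSpecial k r (suc (T p + m)))
  isSpecial-inside {p} {m} 0<m m≤p special with p′ , _ , e ← isSpecial-sound {T p + m} special =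
    <⇒≱ (T-cancel-< {p} {p′} (<-≤-trans (m<m+n (T p) 0<m) (≤-reflexive e)))
        (≤-pred (T-cancel-< {p′} {suc p} (≤-<-trans (≤-reflexive (sym e)) (+-monoʳ-< (T p) (s≤s m≤p)))))

  A-T : ∀ {p} → p ≤ k → A k r (suc (T p)) ≡ suc (atLeast (k + 2 ∸ r) p)
  A-T {p} p≤k rewrite ≤ᵇ-true (s≤s (T-mono-≤ p≤k)) | isSpecial-T p≤k =
    sym (if-float suc (k + 2 ∸ r ≤ᵇ p))

  A-inside : ∀ {p m} → 0 < m → m ≤ p → p < k → A k r (suc (T p + m)) ≡ 1
  A-inside {p} {m} 0<m m≤p p<k
    rewrite ≤ᵇ-true (s≤s (≤-trans (+-monoʳ-≤ (T p) (m≤n⇒m≤1+n m≤p)) (T-mono-≤ p<k)))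
    with isSpecial k r (suc (T p + m)) | isSpecial-inside 0<m m≤p
  ... | false | _           = refl
  ... | true  | not-special = contradiction _ not-special

  A-beyond : ∀ {j} → T k < j → A k r (suc j) ≡ 0
  A-beyond Tk<j rewrite ≤ᵇ-false (s≤s Tk<j) = refl

  A-heaviside : ∀ m n → m + n ≡ k → ∀ i →
                A k r (suc (T m + i)) ≡ ⟦ heaviside (atLeast (k + 2 ∸ r)) m n ⟧ i
  A-heaviside m zero    m+0≡k zero    rewrite +-identityʳ (T m) =
    A-T (≤-reflexive (trans (sym (+-identityʳ m)) m+0≡k))
  A-heaviside m zero    m+0≡k (suc i) rewrite trans (sym (+-identityʳ m)) m+0≡k =
    A-beyond (m<m+n (T k) z<s)
  A-heaviside m (suc n) e     zero    rewrite +-identityʳ (T m) =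
    A-T (≤-trans (m≤m+n m (suc n)) (≤-reflexive e))
  A-heaviside m (suc n) e     (suc i) =
    ⟦replicate-++⟧-intro m (λ j j<m → A-inside z<s j<m m<k) tail i
    where
    m<k : m < k
    m<k = <-≤-trans (m<m+n m z<s) (≤-reflexive e)
    tail : ∀ j → A k r (suc (T m + suc (m + j))) ≡ ⟦ heaviside (atLeast (k + 2 ∸ r)) (suc m) n ⟧ j
    tail j = trans (cong (λ x → A k r (suc x)) (sym (+-assoc (T m) (suc m) j)))
                   (A-heaviside (suc m) n (trans (sym (+-suc m n)) e) j)

  A≈heaviside : A k r ≗ M⁺ 0 ⟦ heaviside (atLeast (k + 2 ∸ r)) 0 k ⟧
  A≈heaviside zero    = refl
  A≈heaviside (suc i) =
    trans (A-heaviside 0 k refl i) (cong (_+ ⟦ heaviside (atLeast (k + 2 ∸ r)) 0 k ⟧ i) (sym (0∸n≡0 i)))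

A-after-T : ∀ q w → let k = q + suc w in
  Φ^ (T k) (A k (2 + q)) ≗ M⁺ k ⟦ 2 ∷ replicate q 1 ++ replicate (suc w) 0 ⟧
A-after-T q w = begin
    Φ^ (T k) (A k r)
  ≈⟨ Φ^-cong (T k) A≈heaviside ⟩
    Φ^ (T k) (M⁺ 0 ⟦ heaviside (atLeast (k + 2 ∸ r)) 0 k ⟧)
  ≈⟨ heaviside-T (atLeast-≤1 (k + 2 ∸ r)) k ⟩
    M⁺ k ⟦ suc (atLeast (k + 2 ∸ r) k) ∷ applyDownFrom (atLeast (k + 2 ∸ r)) k ⟧
  ≈⟨ M⁺-≡ (cong (λ t → suc (atLeast t k) ∷ applyDownFrom (atLeast t) k) threshold) ⟩
    M⁺ k ⟦ suc (atLeast (suc w) k) ∷ applyDownFrom (atLeast (suc w)) k ⟧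
  ≈⟨ M⁺-≡ (cong₂ _∷_ (cong (λ b → suc (if b then 1 else 0)) (≤ᵇ-true (m≤n+m (suc w) q)))
                      (applyDownFrom-atLeast q (suc w))) ⟩
    M⁺ k ⟦ 2 ∷ replicate q 1 ++ replicate (suc w) 0 ⟧
  ∎
  where
  open ≗-Reasoning
  k = q + suc w
  r = 2 + q
  threshold : k + 2 ∸ r ≡ suc w
  threshold = trans (cong (_∸ r) (+-comm k 2)) (m+n∸m≡n q (suc w))

¬isAug-overflow : ∀ {k} Q → suc (length Q) ≡ k → ¬ IsAugMarching (M⁺ k ⟦ 0 ∷ Q ++ 1 ∷ 1 ∷ [] ⟧)
¬isAug-overflow {k} Q |Q| aug = 1+n≢0 (trans (sym overflow) (isAug-gap aug))
  where
  f = M⁺ k ⟦ 0 ∷ Q ++ 1 ∷ 1 ∷ [] ⟧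
  overflow : f (suc (suc (f 1))) ≡ 1
  overflow = trans (cong (λ i → f (suc (suc i))) (+-identityʳ k))
                   (cong₂ _+_ (m≤n⇒m∸n≡0 (n≤1+n k))
                              (trans (cong ⟦ Q ++ 1 ∷ 1 ∷ [] ⟧ (trans (sym |Q|) (+-comm 1 (length Q))))
                                     (⟦++⟧ʳ Q 1)))

heaviside-biaug-depth : ∀ q w → let k = q + suc w in
  IsBiaugMarching q k (Φ^ (T k) (A k (2 + q))) × HasDepth (A k (2 + q)) (T k + q * (k + 2) + 2)
heaviside-biaug-depth q w =
  isBiaug-intro (All.replicate⁺ w z≤n) (length-replicate w) (λ i _ → A-after-T q w i) ,
  bits⇒isAug (k , final , |final| , final≤1 , λ i _ → atX+2 i) ,
  notYet
  where
  open ≗-Reasoning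
  k = q + suc w
  X = T k + q * (k + 2)
  queue = replicate w 0 ++ replicate q 1
  final = (queue ++ [ 1 ]) ++ [ 1 ]

  |queue| : suc (length queue) ≡ k
  |queue| = trans (cong suc (trans (length-++ (replicate w 0))
                                   (cong₂ _+_ (length-replicate w) (length-replicate q))))
                  (trans (cong suc (+-comm w q)) (sym (+-suc q w)))

  atX : Φ^ X (A k (2 + q)) ≗ M⁺ k ⟦ 2 ∷ 0 ∷ queue ⟧
  atX = begin
      Φ^ (T k + q * (k + 2)) (A k (2 + q))
    ≡⟨ Φ^-+ (T k) (q * (k + 2)) (A k (2 + q)) ⟩
      Φ^ (q * (k + 2)) (Φ^ (T k) (A k (2 + q)))
    ≈⟨ Φ^-cong (q * (k + 2)) (A-after-T q w) ⟩
      Φ^ (q * (k + 2)) (M⁺ k ⟦ 2 ∷ replicate q 1 ++ replicate (suc w) 0 ⟧)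
    ≈⟨ rounds q (replicate (suc w) 0) (All.replicate⁺ (suc w) z≤n)
              (trans (length-++ (replicate q 1))
                     (cong₂ _+_ (length-replicate q) (length-replicate (suc w)))) ⟩
      M⁺ k ⟦ 2 ∷ 0 ∷ queue ⟧
    ∎

  atX+1 : Φ^ (suc X) (A k (2 + q)) ≗ M⁺ k ⟦ 0 ∷ queue ++ 1 ∷ 1 ∷ [] ⟧
  atX+1 = begin
      Φ (Φ^ X (A k (2 + q)))
    ≈⟨ Φ-cong (λ i _ → atX i) ⟩
      Φ (M⁺ k ⟦ 2 ∷ 0 ∷ queue ⟧)
    ≈⟨ Φ-M⁺-last (0 ∷ queue) |queue| (λ _ → refl) ⟩
      M⁺ k ⟦ 0 ∷ queue ++ 1 ∷ 1 ∷ [] ⟧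
    ∎

  atX+2 : Φ^ (X + 2) (A k (2 + q)) ≗ M⁺ k ⟦ final ⟧
  atX+2 = begin
      Φ^ (X + 2) (A k (2 + q))
    ≡⟨ Φ^-+ X 2 (A k (2 + q)) ⟩
      Φ (Φ^ (suc X) (A k (2 + q)))
    ≈⟨ Φ-cong (λ i _ → trans (atX+1 i) (M⁺-≡ (cong (0 ∷_) (sym (++-assoc queue [ 1 ] [ 1 ]))) i)) ⟩
      Φ (M⁺ k ⟦ [ 0 ] ++ (queue ++ [ 1 ]) ++ [ 1 ] ⟧)
    ≈⟨ rotate [ 0 ] (queue ++ [ 1 ]) [ 1 ] (z≤n ∷ []) (cong suc (trans (length-++-[] queue) |queue|)) ⟩
      M⁺ k ⟦ final ⟧
    ∎

  |final| : length final ≡ suc k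
  |final| = trans (length-++-[] (queue ++ [ 1 ])) (cong suc (trans (length-++-[] queue) |queue|))

  notYet : ∀ t → t < X + 2 → ¬ IsAugMarching (Φ^ t (A k (2 + q)))
  notYet t t<X+2 aug =
    ¬isAug-overflow queue |queue| (isAug-resp-≈c (λ i _ → atX+1 i) (isAug-Φ^-mono t≤X+1 aug))
    where
    t≤X+1 : t ≤ suc X
    t≤X+1 = ≤-pred (≤-trans t<X+2 (≤-reflexive (+-comm X 2)))

  final≤1 : All (_≤ 1) final
  final≤1 = All.++⁺ (All.++⁺ (All.++⁺ (All.replicate⁺ w z≤n) (All.replicate⁺ q ≤-refl)) (≤-refl ∷ []))
                    (≤-refl ∷ [])

mainTheorem9 : (k r : ℕ) → 1 ≤ k → 2 ≤ r → r ≤ k + 1 →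
    IsBiaugMarching (r ∸ 2) k (Φ^ (T k) (A k r)) ×
    HasDepth (A k r) (T k + (r ∸ 2) * (k + 2) + 2)
-- The hypothesis 1 ≤ k is implied by 2 ≤ r ≤ k + 1.
mainTheorem9 k zero          _ ()             _
mainTheorem9 k (suc zero)    _ (s≤s ())       _
mainTheorem9 k (suc (suc q)) _ _ r≤k+1 =
  subst (λ k → IsBiaugMarching q k (Φ^ (T k) (A k (2 + q))) ×
               HasDepth (A k (2 + q)) (T k + q * (k + 2) + 2))
        (trans (+-suc q (k ∸ suc q)) (m+[n∸m]≡n q<k))
        (heaviside-biaug-depth q (k ∸ suc q))
  where
  q<k : q < k
  q<k = ≤-pred (≤-trans r≤k+1 (≤-reflexive (+-comm k 1)))
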